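{- Let $n\ge 1$. Over a binary alphabet, every integer $l$ with $8\le l\le n$ is the palindromic richness of some binary word of length $n$. Over a $k$-ary alphabet with $k>2$, every integer $l$ with $k\le l\le n$ is the palindromic richness of some $k$-ary word of length $n$.
   Context: A word $a_1\cdots a_n$ is a palindrome if $a_1\cdots a_n=a_n\cdots a_1$; the empty word is not counted as a palindrome. The palindromic richness of a word $w$ is the number of distinct non-empty palindromes that occur as factors (contiguous subwords) of $w$. -}

module Defs where

open import Data.Nat using (ℕ; zero; suc)
open import Data.Fin using (Fin)
open import Data.Fin.Properties using () renaming (_≟_ to _≟ᶠ_)
open import Data.List using (List; []; _∷_; reverse; length; filter; deduplicate; concatMap; inits; tails)
open import Data.List.Properties using (≡-dec)
open import Relation.Binary.PropositionalEquality using (_≡_)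
open import Relation.Nullary using (Dec; yes; no)

Word : ℕ → Set
Word k = List (Fin k)

_≟w_ : {k : ℕ} → (u v : Word k) → Dec (u ≡ v)
_≟w_ = ≡-dec _≟ᶠ_

-- A palindrome is a NON-EMPTY word equal to its reversal.
IsPalindrome : {k : ℕ} → Word k → Set
IsPalindrome [] = Data.Empty.⊥ where import Data.Empty
IsPalindrome (a ∷ u) = (a ∷ u) ≡ reverse (a ∷ u)

isPalindrome? : {k : ℕ} → (w : Word k) → Dec (IsPalindrome w)
isPalindrome? [] = no (λ ())
isPalindrome? (a ∷ u) = (a ∷ u) ≟w reverse (a ∷ u)

factors : {k : ℕ} → Word k → List (Word k)
factors w = concatMap inits (tails w)

richness : {k : ℕ} → Word k → ℕ
richness w = length (deduplicate _≟w_ (filter isPalindrome? (factors w)))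

module Submission where

-- Every value l in the claimed range is the richness of a word aᵐ · c, a block
-- of a letter a followed by a prefix of a periodic word c starting with a
-- letter ≠ a.  Binary: c = (110010)^ω, a = 0, and 0·c has richness 8 while 0ᵐ·c
-- (m ≥ 2) has 7 + m.  k-ary: c = (120)^ω, a = 0, and 0ᵐ·c (m ≥ 1) has 2 + m.
-- Two general facts carry the proof.
--  * Block growth: if Y starts with y ≠ a and avoids the block aʲ⁺¹, then
--    prepending a to aʲ·Y creates exactly one new palindrome, aʲ⁺¹.
--  * Tail stability: if c has no palindromes of length B and B + 1 (hence none
--    of length ≥ B), palindromic factors of X·c are short, so lengthening the
--    tail beyond |X| + B leaves the richness unchanged.

open import Defs
open import Data.Nat using (ℕ; zero; suc; pred; _+_; _≤_; _<_; z≤n; s≤s)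
open import Data.Nat.Properties
  using (≤-refl; ≤-trans; <⇒≤; +-comm; +-monoˡ-≤; m≤m+n; m≤n+m; m≤n⇒∃[o]m+o≡n; m≤n⇒m<n∨m≡n; ≰⇒>; _≤?_)
open import Data.Nat.Tactic.RingSolver using (solve-∀)
open import Data.Product using (_×_; _,_; ∃; ∃₂; ∃-syntax; proj₁; proj₂)
open import Data.Sum using (_⊎_; inj₁; inj₂)
open import Data.List using (List; []; _∷_; _++_; [_]; length; replicate; reverse; inits; filter; deduplicate)
open import Data.List.Properties
  using (∷-injective; ∷-injectiveˡ; ∷-injectiveʳ; ++-assoc; ++-identityʳ; reverse-++; unfold-reverse; length-reverse; length-++; length-++-≤ʳ; length-replicate)
open import Data.List.Membership.Propositional using (_∈_)
open import Data.List.Membership.Propositional.Properties using (∈-++⁺ˡ; ∈-++⁺ʳ; ∈-++⁻; ∈-map⁺; ∈-map⁻; ∈-filter⁺; ∈-filter⁻; ∈-deduplicate⁺; ∈-deduplicate⁻)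
open import Data.List.Membership.Propositional.Properties.WithK using (unique∧set⇒bag)
open import Data.List.Relation.Binary.BagAndSetEquality using (∼bag⇒↭)
open import Data.List.Relation.Binary.Permutation.Propositional.Properties using (↭-length)
open import Data.List.Relation.Unary.Any using (here; there)
open import Data.List.Relation.Unary.All using (All) renaming (lookup to lookupAll)
open import Data.List.Relation.Unary.AllPairs using (_∷_)
import Data.List.Relation.Unary.All as All
open import Data.List.Relation.Unary.Unique.Propositional using (Unique)
open import Data.List.Relation.Unary.Unique.DecPropositional.Properties using (deduplicate-!)
open import Data.Empty using (⊥-elim)
open import Data.Fin using (Fin; zero; suc)
import Data.Fin.Properties as Fin
open import Function.Bundles using (_⇔_; mk⇔; Equivalence)
import Function.Properties.Equivalence as ⇔
open import Relation.Binary.PropositionalEquality using (_≡_; _≢_; refl; sym; trans; cong; cong₂; subst; module ≡-Reasoning)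
open import Relation.Nullary using (¬_; Dec; yes; no; ¬?)
open import Relation.Nullary.Decidable using (from-yes; _→-dec_)

module _ {A : Set} where

  ++-equidivisible : ∀ (xs ys us vs : List A) → xs ++ ys ≡ us ++ vs →
    (∃ λ f → us ≡ xs ++ f × ys ≡ f ++ vs) ⊎ (∃ λ f → xs ≡ us ++ f × vs ≡ f ++ ys)
  ++-equidivisible [] ys us vs eq = inj₁ (us , refl , eq)
  ++-equidivisible (x ∷ xs) ys [] vs eq = inj₂ (x ∷ xs , refl , sym eq)
  ++-equidivisible (x ∷ xs) ys (u ∷ us) vs eq with ∷-injective eq
  ... | refl , eq′ with ++-equidivisible xs ys us vs eq′
  ... | inj₁ (f , p , q) = inj₁ (f , cong (x ∷_) p , q)
  ... | inj₂ (f , p , q) = inj₂ (f , cong (x ∷_) p , q)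

  ++-injective-length : ∀ (xs ys us vs : List A) → length xs ≡ length us →
    xs ++ ys ≡ us ++ vs → xs ≡ us × ys ≡ vs
  ++-injective-length [] ys [] vs _ eq = refl , eq
  ++-injective-length (x ∷ xs) ys (u ∷ us) vs len eq with ∷-injective eq
  ... | refl , eq′ with ++-injective-length xs ys us vs (cong pred len) eq′
  ... | refl , eq″ = refl , eq″

  inits⁻ : ∀ {z} (w : List A) → z ∈ inits w → ∃ λ t → w ≡ z ++ t
  inits⁻ [] (here refl) = [] , refl
  inits⁻ (x ∷ w) (here refl) = x ∷ w , refl
  inits⁻ (x ∷ w) (there p) with ∈-map⁻ (x ∷_) p
  ... | _ , q , refl with inits⁻ w q
  ... | t , eq = t , cong (x ∷_) eq

  inits⁺ : ∀ (z : List A) {w} t → w ≡ z ++ t → z ∈ inits w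
  inits⁺ [] {[]} t eq = here refl
  inits⁺ [] {x ∷ w} t eq = here refl
  inits⁺ (x ∷ z) {y ∷ w} t eq with ∷-injective eq
  ... | refl , eq′ = there (∈-map⁺ (x ∷_) (inits⁺ z t eq′))

  inits-++ʳ : ∀ {z} (w t : List A) → z ∈ inits w → z ∈ inits (w ++ t)
  inits-++ʳ w t p with inits⁻ w p
  ... | u , refl = inits⁺ _ (u ++ t) (++-assoc _ u t)

  inits-++ˡ : ∀ (X : List A) {e Y} → e ∈ inits Y → X ++ e ∈ inits (X ++ Y)
  inits-++ˡ X {e} p with inits⁻ _ p
  ... | u , refl = inits⁺ (X ++ e) u (sym (++-assoc X e u))

  inits-++⁻ : ∀ (X : List A) {Y z} → z ∈ inits (X ++ Y) →
    z ∈ inits X ⊎ (∃ λ e → z ≡ X ++ e × e ∈ inits Y)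
  inits-++⁻ [] p = inj₂ (_ , refl , p)
  inits-++⁻ (x ∷ X) (here refl) = inj₁ (here refl)
  inits-++⁻ (x ∷ X) (there p) with ∈-map⁻ (x ∷_) p
  ... | _ , q , refl with inits-++⁻ X q
  ... | inj₁ r = inj₁ (there (∈-map⁺ (x ∷_) r))
  ... | inj₂ (e , refl , r) = inj₂ (e , refl , r)

  replicate-+-++ : ∀ (a : A) m n t → replicate (m + n) a ++ t ≡ replicate m a ++ replicate n a ++ t
  replicate-+-++ a zero n t = refl
  replicate-+-++ a (suc m) n t = cong (a ∷_) (replicate-+-++ a m n t)

  reverse-replicate : ∀ (a : A) n → reverse (replicate n a) ≡ replicate n a
  reverse-replicate a zero = refl
  reverse-replicate a (suc n) = begin
    reverse (a ∷ replicate n a)       ≡⟨ unfold-reverse a (replicate n a) ⟩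
    reverse (replicate n a) ++ [ a ]  ≡⟨ cong (_++ [ a ]) (reverse-replicate a n) ⟩
    replicate n a ++ [ a ]            ≡⟨ snoc n ⟩
    a ∷ replicate n a                 ∎
    where
    open ≡-Reasoning
    snoc : ∀ n → replicate n a ++ [ a ] ≡ a ∷ replicate n a
    snoc zero = refl
    snoc (suc n) = cong (a ∷_) (snoc n)

  ∈-replicate⁻ : ∀ {x y : A} n → x ∈ replicate n y → x ≡ y
  ∈-replicate⁻ (suc n) (here refl) = refl
  ∈-replicate⁻ (suc n) (there p) = ∈-replicate⁻ n p

  inits-replicate : ∀ {z} {a : A} n → z ∈ inits (replicate n a) → ∃ λ i → i ≤ n × z ≡ replicate i a
  inits-replicate zero (here refl) = 0 , z≤n , refl
  inits-replicate (suc n) (here refl) = 0 , z≤n , refl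
  inits-replicate {a = a} (suc n) (there p) with ∈-map⁻ (a ∷_) p
  ... | _ , q , refl with inits-replicate n q
  ... | i , i≤n , refl = suc i , s≤s i≤n , refl

  replicate∈inits : ∀ (a : A) {i n} Y → i ≤ n → replicate i a ∈ inits (replicate n a ++ Y)
  replicate∈inits a {zero} Y _ = inits⁺ [] _ refl
  replicate∈inits a {suc i} {suc n} Y (s≤s i≤n) = there (∈-map⁺ (a ∷_) (replicate∈inits a Y i≤n))

module _ {k : ℕ} where

  -- Prefixes are factors (factors w lists the prefixes of w first).
  inits⊆factors : ∀ {z : Word k} w → z ∈ inits w → z ∈ factors w
  inits⊆factors w p = ∈-++⁺ˡ p

  inits⊆factors-++ : ∀ (u : Word k) {v z} → z ∈ inits v → z ∈ factors (u ++ v)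
  inits⊆factors-++ [] p = inits⊆factors _ p
  inits⊆factors-++ (x ∷ u) p = ∈-++⁺ʳ (inits (x ∷ u ++ _)) (inits⊆factors-++ u p)

  factors⁻ : ∀ {z : Word k} w → z ∈ factors w → ∃₂ λ s t → w ≡ s ++ z ++ t
  factors⁻ [] (here refl) = [] , [] , refl
  factors⁻ (x ∷ w) p with ∈-++⁻ (inits (x ∷ w)) p
  ... | inj₁ q with inits⁻ (x ∷ w) q
  ...   | t , eq = [] , t , eq
  factors⁻ (x ∷ w) p | inj₂ q with factors⁻ w q
  ... | s , t , eq = x ∷ s , t , cong (x ∷_) eq

  factors-++⁻ : ∀ (X : Word k) {Y z} → z ∈ factors (X ++ Y) →
    z ∈ factors Y ⊎ (∃₂ λ X₁ X₂ → X ≡ X₁ ++ X₂ × z ∈ inits (X₂ ++ Y))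
  factors-++⁻ [] p = inj₁ p
  factors-++⁻ (x ∷ X) {Y} p with ∈-++⁻ (inits (x ∷ X ++ Y)) p
  ... | inj₁ q = inj₂ ([] , x ∷ X , refl , q)
  ... | inj₂ q with factors-++⁻ X q
  ...   | inj₁ r = inj₁ r
  ...   | inj₂ (X₁ , X₂ , refl , r) = inj₂ (x ∷ X₁ , X₂ , refl , r)

  factors-++ʳ : ∀ {z : Word k} w t → z ∈ factors w → z ∈ factors (w ++ t)
  factors-++ʳ [] t (here refl) = ∈-++⁺ˡ {xs = inits t} (here refl)
  factors-++ʳ (x ∷ w) t p with ∈-++⁻ (inits (x ∷ w)) p
  ... | inj₁ q = ∈-++⁺ˡ (inits-++ʳ (x ∷ w) t q)
  ... | inj₂ q = ∈-++⁺ʳ (inits (x ∷ w ++ t)) (factors-++ʳ w t q)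

  Pal : Word k → Set
  Pal w = w ≡ reverse w

  pal? : (w : Word k) → Dec (Pal w)
  pal? w = w ≟w reverse w

  IsPalindrome⇒Pal : ∀ z → IsPalindrome z → Pal z
  IsPalindrome⇒Pal (x ∷ z) p = p

  Pal-inner : ∀ (X v Z : Word k) → length X ≡ length Z → Pal (X ++ v ++ Z) → Pal v
  Pal-inner X v Z len pal =
    proj₁ (++-injective-length v Z (reverse v) (reverse X) (sym (length-reverse v)) outer)
    where
    open ≡-Reasoning
    mirrored : X ++ v ++ Z ≡ reverse Z ++ reverse v ++ reverse X
    mirrored = begin
      X ++ v ++ Z                           ≡⟨ pal ⟩
      reverse (X ++ v ++ Z)                 ≡⟨ reverse-++ X (v ++ Z) ⟩
      reverse (v ++ Z) ++ reverse X         ≡⟨ cong (_++ reverse X) (reverse-++ v Z) ⟩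
      (reverse Z ++ reverse v) ++ reverse X ≡⟨ ++-assoc (reverse Z) (reverse v) (reverse X) ⟩
      reverse Z ++ reverse v ++ reverse X   ∎
    outer : v ++ Z ≡ reverse v ++ reverse X
    outer = proj₂ (++-injective-length X _ (reverse Z) _ (trans len (sym (length-reverse Z))) mirrored)

module _ {k : ℕ} where

  PalFactor : Word k → Word k → Set
  PalFactor w z = z ∈ factors w × IsPalindrome z

  palFactors : Word k → List (Word k)
  palFactors w = deduplicate _≟w_ (filter isPalindrome? (factors w))

  ∈-palFactors : ∀ w {z} → z ∈ palFactors w ⇔ PalFactor w z
  ∈-palFactors w = mk⇔
    (λ p → ∈-filter⁻ isPalindrome? (∈-deduplicate⁻ _≟w_ _ p))
    (λ (f , p) → ∈-deduplicate⁺ _≟w_ (∈-filter⁺ isPalindrome? f p))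

  richness-≡-length : ∀ w (S : List (Word k)) → Unique S →
    (∀ {z} → z ∈ S ⇔ PalFactor w z) → richness w ≡ length S
  richness-≡-length w S uniqueS S⇔ = sym (↭-length (∼bag⇒↭
    (unique∧set⇒bag uniqueS (deduplicate-! _≟w_ _) (⇔.trans S⇔ (⇔.sym (∈-palFactors w))))))

  richness-cong : ∀ w w′ → (∀ {z} → PalFactor w z → PalFactor w′ z) →
    (∀ {z} → PalFactor w′ z → PalFactor w z) → richness w ≡ richness w′
  richness-cong w w′ to from =
    richness-≡-length w (palFactors w′) (deduplicate-! _≟w_ _) (⇔.trans (∈-palFactors w′) (mk⇔ from to))

NoBlock : {k : ℕ} → Fin k → ℕ → Word k → Set
NoBlock a m Y = ∀ s t → Y ≢ s ++ replicate m a ++ t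

noBlock-mono : ∀ {k} {a : Fin k} {m m′ Y} → m ≤ m′ → NoBlock a m Y → NoBlock a m′ Y
noBlock-mono {a = a} {m} m≤m′ noBlock s t eq with m≤n⇒∃[o]m+o≡n m≤m′
... | d , refl = noBlock s (replicate d a ++ t) (trans eq (cong (s ++_) (replicate-+-++ a m d t)))

module BlockGrowth {k : ℕ} (a y : Fin k) (Y′ : Word k) (y≢a : y ≢ a) where

  Y : Word k
  Y = y ∷ Y′

  no-initial-block : ∀ j {m} t → j < m → replicate j a ++ Y ≢ replicate m a ++ t
  no-initial-block zero {suc m} t _ eq = y≢a (∷-injectiveˡ eq)
  no-initial-block (suc j) {suc m} t (s≤s j<m) eq = no-initial-block j t j<m (∷-injectiveʳ eq)

  noBlock-prefix : ∀ j {m} → j < m → NoBlock a m Y → NoBlock a m (replicate j a ++ Y)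
  noBlock-prefix zero _ noBlock = noBlock
  noBlock-prefix (suc j) j<m noBlock [] t eq = no-initial-block (suc j) t j<m eq
  noBlock-prefix (suc j) j<m noBlock (_ ∷ s) t eq = noBlock-prefix j (<⇒≤ j<m) noBlock s t (∷-injectiveʳ eq)

  module _ (j : ℕ) (noBlock : NoBlock a (suc j) Y) where

    block : Word k
    block = replicate (suc j) a

    W : Word k
    W = replicate j a ++ Y

    block∉W : ¬ (block ∈ factors W)
    block∉W p with factors⁻ W p
    ... | s , t , eq = noBlock-prefix j ≤-refl noBlock s t eq

    -- No palindrome aʲ⁺¹ · e with e a non-empty prefix of Y: its last letter
    -- y would lie in the block, or the block would occur inside Y.
    block-palindrome : ∀ e → e ∈ inits Y → Pal (block ++ e) → e ≡ []
    block-palindrome [] _ _ = refl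
    block-palindrome (e₀ ∷ e) r pal with inits⁻ Y r
    ... | t , Y≡ with ∷-injective Y≡
    ... | refl , _ with ++-equidivisible block (y ∷ e) (reverse (y ∷ e)) block mirrored
      where
      mirrored : block ++ y ∷ e ≡ reverse (y ∷ e) ++ block
      mirrored = trans pal (trans (reverse-++ block (y ∷ e)) (cong (reverse (y ∷ e) ++_) (reverse-replicate a (suc j))))
    ... | inj₁ (f , _ , e≡) = ⊥-elim (noBlock f t (trans Y≡ (trans (cong (_++ t) e≡) (++-assoc f block t))))
    ... | inj₂ (f , block≡ , _) = ⊥-elim (y≢a (∈-replicate⁻ (suc j) (subst (y ∈_) (sym block≡) (∈-++⁺ˡ y∈reverse))))
      where
      y∈reverse : y ∈ reverse (y ∷ e)
      y∈reverse = subst (y ∈_) (sym (unfold-reverse y e)) (∈-++⁺ʳ (reverse e) (here refl))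

    palPrefix-dichotomy : ∀ {z} → z ∈ inits (block ++ Y) → Pal z → z ≡ block ⊎ z ∈ inits W
    palPrefix-dichotomy r pal with inits-++⁻ block r
    ... | inj₂ (e , refl , r′) with block-palindrome e r′ pal
    ...   | refl = inj₁ (++-identityʳ block)
    palPrefix-dichotomy r pal | inj₁ r′ with inits-replicate (suc j) r′
    ... | i , i≤1+j , refl with m≤n⇒m<n∨m≡n i≤1+j
    ...   | inj₁ (s≤s i≤j) = inj₂ (replicate∈inits a Y i≤j)
    ...   | inj₂ refl = inj₁ refl

    -- The palindromic factors of a · W are aʲ⁺¹ and those of W.
    growth : richness (block ++ Y) ≡ suc (richness W)
    growth = richness-≡-length (a ∷ W) (block ∷ palFactors W) unique (mk⇔ to from)
      where
      unique : Unique (block ∷ palFactors W)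
      unique = All.tabulate (λ p eq → block∉W (subst (_∈ factors W) (sym eq) (proj₁ (Equivalence.to (∈-palFactors W) p))))
             ∷ deduplicate-! _≟w_ _
      old : ∀ {z} → PalFactor W z → z ∈ block ∷ palFactors W
      old pf = there (Equivalence.from (∈-palFactors W) pf)
      to : ∀ {z} → z ∈ block ∷ palFactors W → PalFactor (a ∷ W) z
      to (here refl) = inits⊆factors (a ∷ W) (inits⁺ block Y refl) , sym (reverse-replicate a (suc j))
      to (there p) with Equivalence.to (∈-palFactors W) p
      ... | f , pal = ∈-++⁺ʳ (inits (a ∷ W)) f , pal
      from : ∀ {z} → PalFactor (a ∷ W) z → z ∈ block ∷ palFactors W
      from {z} (f , pal) with ∈-++⁻ (inits (a ∷ W)) f
      ... | inj₂ f′ = old (f′ , pal)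
      ... | inj₁ r with palPrefix-dichotomy r (IsPalindrome⇒Pal z pal)
      ...   | inj₁ z≡block = here z≡block
      ...   | inj₂ r′ = old (inits⊆factors W r′ , pal)

block-growth : ∀ {k} (a y : Fin k) Y′ → y ≢ a → ∀ m → NoBlock a (suc m) (y ∷ Y′) →
  ∀ d → richness (replicate (d + m) a ++ y ∷ Y′) ≡ d + richness (replicate m a ++ y ∷ Y′)
block-growth a y Y′ y≢a m noBlock zero = refl
block-growth a y Y′ y≢a m noBlock (suc d) =
  trans (BlockGrowth.growth a y Y′ y≢a (d + m) (noBlock-mono (s≤s (m≤n+m m d)) noBlock))
        (cong suc (block-growth a y Y′ y≢a m noBlock d))

-- The periodic word with phases Fin P, successor phase `next`, letter `letter`.
module Periodic {k P : ℕ} (next : Fin P → Fin P) (letter : Fin P → Fin k) where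

  cyc : Fin P → ℕ → Word k
  cyc q zero = []
  cyc q (suc r) = letter q ∷ cyc (next q) r

  shift : ℕ → Fin P → Fin P
  shift zero q = q
  shift (suc n) q = shift n (next q)

  cyc-length : ∀ q r → length (cyc q r) ≡ r
  cyc-length q zero = refl
  cyc-length q (suc r) = cong suc (cyc-length (next q) r)

  cyc-+ : ∀ q m n → cyc q (m + n) ≡ cyc q m ++ cyc (shift m q) n
  cyc-+ q zero n = refl
  cyc-+ q (suc m) n = cong (letter q ∷_) (cyc-+ (next q) m n)

  cyc-snoc : ∀ q n → cyc q (suc n) ≡ cyc q n ++ [ letter (shift n q) ]
  cyc-snoc q zero = refl
  cyc-snoc q (suc n) = cong (letter q ∷_) (cyc-snoc (next q) n)

  length-block-cyc : ∀ m (a : Fin k) q r → length (replicate m a ++ cyc q r) ≡ m + r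
  length-block-cyc m a q r = trans (length-++ (replicate m a)) (cong₂ _+_ (length-replicate m) (cyc-length q r))

  inits-cyc : ∀ {z} q r → z ∈ inits (cyc q r) → z ≡ cyc q (length z)
  inits-cyc q zero (here refl) = refl
  inits-cyc q (suc r) (here refl) = refl
  inits-cyc q (suc r) (there p) with ∈-map⁻ (letter q ∷_) p
  ... | _ , p′ , refl = cong (letter q ∷_) (inits-cyc (next q) r p′)

  cyc∈inits : ∀ q {m n} → m ≤ n → cyc q m ∈ inits (cyc q n)
  cyc∈inits q {zero} _ = inits⁺ [] _ refl
  cyc∈inits q {suc m} {suc n} (s≤s m≤n) = there (∈-map⁺ (letter q ∷_) (cyc∈inits (next q) m≤n))

  factors-cyc : ∀ {z} q r → z ∈ factors (cyc q r) → ∃₂ λ q′ r′ → z ∈ inits (cyc q′ r′)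
  factors-cyc q zero (here refl) = q , zero , here refl
  factors-cyc q (suc r) p with ∈-++⁻ (inits (cyc q (suc r))) p
  ... | inj₁ p′ = q , suc r , p′
  ... | inj₂ p′ = factors-cyc (next q) r p′

  suffix-cyc : ∀ q r s u → cyc q r ≡ s ++ u → ∃₂ λ q′ r′ → u ≡ cyc q′ r′
  suffix-cyc q r [] u eq = q , r , sym eq
  suffix-cyc q (suc r) (_ ∷ s) u eq = suffix-cyc (next q) r s u (∷-injectiveʳ eq)

  cyc-noBlock : ∀ a m → (∀ q → cyc q m ≢ replicate m a) → ∀ q r → NoBlock a m (cyc q r)
  cyc-noBlock a m noBlockₘ q r s t eq with suffix-cyc q r s _ eq
  ... | q′ , r′ , eq′ = noBlockₘ q′ (trans (cong (cyc q′) (sym (length-replicate m)))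
                          (sym (inits-cyc q′ r′ (inits⁺ (replicate m a) t (sym eq′)))))

  module ShortPalindromes (B : ℕ)
    (noPal-B : ∀ q → ¬ Pal (cyc q B)) (noPal-1+B : ∀ q → ¬ Pal (cyc q (suc B))) where

    -- Stripping both end letters reduces length by 2: no palindromes of length ≥ B.
    cyc-palFree : ∀ d q → ¬ Pal (cyc q (d + B))
    cyc-palFree zero q = noPal-B q
    cyc-palFree (suc zero) q = noPal-1+B q
    cyc-palFree (suc (suc d)) q pal = cyc-palFree d (next q)
      (Pal-inner [ letter q ] (cyc (next q) (d + B)) [ _ ] refl
        (subst (λ v → Pal (letter q ∷ v)) (cyc-snoc (next q) (d + B)) pal))

    -- X · cyc q L is not a palindrome once L ≥ |X| + B: its core is too long.
    no-long-palindrome : ∀ X q L → length X + B ≤ L → ¬ Pal (X ++ cyc q L)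
    no-long-palindrome X q L bound pal with m≤n⇒∃[o]m+o≡n bound
    ... | d , refl = cyc-palFree d q (Pal-inner X (cyc q (d + B)) (cyc (shift (d + B) q) (length X))
        (sym (cyc-length _ (length X))) (subst (λ v → Pal (X ++ v)) split pal))
      where
      split : cyc q (length X + B + d) ≡ cyc q (d + B) ++ cyc (shift (d + B) q) (length X)
      split = trans (cong (cyc q) (reorder (length X) B d)) (cyc-+ q (d + B) (length X))
        where
        reorder : ∀ x b d → x + b + d ≡ d + b + x
        reorder = solve-∀

    palPrefix-bounded : ∀ X q r N → length X + B ≤ suc N → ∀ {z} →
      z ∈ inits (X ++ cyc q r) → IsPalindrome z → z ∈ inits (X ++ cyc q N)
    palPrefix-bounded X q r N bound {z} p isPal with inits-++⁻ X p
    ... | inj₁ r′ = inits-++ʳ X _ r′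
    ... | inj₂ (e , refl , r′) with inits-cyc q r r′ | length e ≤? N
    ...   | e≡ | yes short = inits-++ˡ X (subst (_∈ inits (cyc q N)) (sym e≡) (cyc∈inits q short))
    ...   | e≡ | no long = ⊥-elim (no-long-palindrome X q (length e) (≤-trans bound (≰⇒> long))
              (subst (λ v → Pal (X ++ v)) e≡ (IsPalindrome⇒Pal z isPal)))

    cyc-palFactor : ∀ q r {z} → z ∈ factors (cyc q r) → IsPalindrome z → ∃ λ q′ → z ∈ inits (cyc q′ B)
    cyc-palFactor q r p isPal with factors-cyc q r p
    ... | q′ , r′ , p′ = q′ , palPrefix-bounded [] q′ r′ B (m≤n+m B 1) p′ isPal

    Covers : Word k → Set
    Covers W = ∀ q → All (λ z → IsPalindrome z → z ∈ factors W) (inits (cyc q B))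

    -- For concrete W and B this is checked by evaluation.
    covers? : ∀ W → Dec (Covers W)
    covers? W = Fin.all? (λ q → All.all? (λ z → isPalindrome? z →-dec (z ∈? factors W)) (inits (cyc q B)))
      where open import Data.List.Membership.DecPropositional (_≟w_ {k}) using (_∈?_)

    tail-stable : ∀ X q N e → length X + B ≤ suc N → Covers (X ++ cyc q N) →
      richness (X ++ cyc q (N + e)) ≡ richness (X ++ cyc q N)
    tail-stable X q N e bound covers = richness-cong (X ++ cyc q (N + e)) (X ++ cyc q N) shrink grow
      where
      shrink : ∀ {z} → PalFactor (X ++ cyc q (N + e)) z → PalFactor (X ++ cyc q N) z
      shrink {z} (f , isPal) with factors-++⁻ X f
      ... | inj₁ f′ with cyc-palFactor q (N + e) f′ isPal
      ...   | q′ , r = lookupAll (covers q′) r isPal , isPal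
      shrink {z} (f , isPal) | inj₂ (X₁ , X₂ , refl , r) =
        subst (z ∈_) (cong factors (sym (++-assoc X₁ X₂ (cyc q N))))
          (inits⊆factors-++ X₁ (palPrefix-bounded X₂ q (N + e) N
            (≤-trans (+-monoˡ-≤ B (length-++-≤ʳ X₂ {X₁})) bound) r isPal)) , isPal
      grow : ∀ {z} → PalFactor (X ++ cyc q N) z → PalFactor (X ++ cyc q (N + e)) z
      grow {z} (f , isPal) = subst (λ v → z ∈ factors (X ++ v)) (sym (cyc-+ q N e))
        (subst (z ∈_) (cong factors (++-assoc X (cyc q N) tail)) (factors-++ʳ (X ++ cyc q N) tail f)) , isPal
        where
        tail : Word k
        tail = cyc (shift N q) e

module Binary where

  o i : Fin 2
  o = zero
  i = suc zero

  -- c read from phase 0 is 110010 110010 …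
  next : Fin 6 → Fin 6
  next zero = suc zero
  next (suc zero) = suc (suc zero)
  next (suc (suc zero)) = suc (suc (suc zero))
  next (suc (suc (suc zero))) = suc (suc (suc (suc zero)))
  next (suc (suc (suc (suc zero)))) = suc (suc (suc (suc (suc zero))))
  next (suc (suc (suc (suc (suc zero))))) = zero

  letter : Fin 6 → Fin 2
  letter zero = i
  letter (suc zero) = i
  letter (suc (suc zero)) = o
  letter (suc (suc (suc zero))) = o
  letter (suc (suc (suc (suc zero)))) = i
  letter (suc (suc (suc (suc (suc zero))))) = o

  open Periodic next letter
  open ShortPalindromes 5 (from-yes (Fin.all? λ q → ¬? (pal? (cyc q 5))))
                          (from-yes (Fin.all? λ q → ¬? (pal? (cyc q 6))))

  -- 0 · 1100101 has the 8 palindromes 0, 1, 00, 11, 010, 101, 0110, 1001.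
  richness₈ : ∀ e → richness (o ∷ cyc zero (7 + e)) ≡ 8
  richness₈ e = trans (tail-stable [ o ] zero 7 e (m≤m+n 6 2)
                        (from-yes (covers? (o ∷ cyc zero 7))))
                      refl

  -- 00 · 1100101 has the additional palindrome 001100.
  richness₉ : ∀ e → richness (o ∷ o ∷ cyc zero (7 + e)) ≡ 9
  richness₉ e = trans (tail-stable (o ∷ [ o ]) zero 7 e (m≤m+n 7 1)
                        (from-yes (covers? (o ∷ o ∷ cyc zero 7))))
                      refl

  noBlock₃ : ∀ r → NoBlock o 3 (cyc zero r)
  noBlock₃ = cyc-noBlock o 3 (from-yes (Fin.all? λ q → ¬? (cyc q 3 ≟w replicate 3 o))) zero

  realise : ∀ c e → ∃[ w ] (length {A = Fin 2} w ≡ 8 + c + e × richness w ≡ 8 + c)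
  realise zero e = o ∷ cyc zero (7 + e) , cong suc (cyc-length zero (7 + e)) , richness₈ e
  realise (suc d) e = replicate (d + 2) o ++ cyc zero (7 + e)
    , trans (length-block-cyc (d + 2) o zero (7 + e)) (total d e)
    , trans (block-growth o i (cyc (suc zero) (6 + e)) (λ ()) 2 (noBlock₃ (7 + e)) d)
            (trans (cong (d +_) (richness₉ e)) (+-comm d 9))
    where
    total : ∀ d e → d + 2 + (7 + e) ≡ 8 + suc d + e
    total = solve-∀

module Kary (k′ : ℕ) where

  a₀ a₁ a₂ : Fin (3 + k′)
  a₀ = zero
  a₁ = suc zero
  a₂ = suc (suc zero)

  -- c read from phase 0 is 120 120 …
  next : Fin 3 → Fin 3
  next zero = suc zero
  next (suc zero) = suc (suc zero)
  next (suc (suc zero)) = zero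

  letter : Fin 3 → Fin (3 + k′)
  letter zero = a₁
  letter (suc zero) = a₂
  letter (suc (suc zero)) = a₀

  open Periodic next letter
  open ShortPalindromes 2 (from-yes (Fin.all? λ q → ¬? (pal? (cyc q 2))))
                          (from-yes (Fin.all? λ q → ¬? (pal? (cyc q 3))))

  -- 0 · 12 has the 3 palindromes 0, 1, 2.
  richness₃ : ∀ e → richness (a₀ ∷ cyc zero (2 + e)) ≡ 3
  richness₃ e = trans (tail-stable [ a₀ ] zero 2 e ≤-refl (from-yes (covers? (a₀ ∷ cyc zero 2)))) refl

  noBlock₂ : ∀ r → NoBlock a₀ 2 (cyc zero r)
  noBlock₂ = cyc-noBlock a₀ 2 (from-yes (Fin.all? λ q → ¬? (cyc q 2 ≟w replicate 2 a₀))) zero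

  realise : ∀ c e → ∃[ w ] (length {A = Fin (3 + k′)} w ≡ 3 + c + e × richness w ≡ 3 + c)
  realise c e = replicate (c + 1) a₀ ++ cyc zero (2 + e)
    , trans (length-block-cyc (c + 1) a₀ zero (2 + e)) (total c e)
    , trans (block-growth a₀ a₁ (cyc (suc zero) (1 + e)) (λ ()) 1 (noBlock₂ (2 + e)) c)
            (trans (cong (c +_) (richness₃ e)) (+-comm c 3))
    where
    total : ∀ c e → c + 1 + (2 + e) ≡ 3 + c + e
    total = solve-∀

realise-range : ∀ {k} lo → (∀ c e → ∃[ w ] (length {A = Fin k} w ≡ lo + c + e × richness w ≡ lo + c)) →
  ∀ n l → lo ≤ l → l ≤ n → ∃[ w ] (length {A = Fin k} w ≡ n × richness {k} w ≡ l)
realise-range lo family n l lo≤l l≤n with m≤n⇒∃[o]m+o≡n lo≤l | m≤n⇒∃[o]m+o≡n l≤n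
... | c , refl | e , refl = family c e

-- Over k ≥ 3 letters the k-ary family reaches every l ≥ 3, in particular every l ≥ k.
kary-range : ∀ n k → 2 < k → ∀ l → k ≤ l → l ≤ n → ∃[ w ] (length {A = Fin k} w ≡ n × richness {k} w ≡ l)
kary-range n (suc (suc (suc k′))) (s≤s (s≤s (s≤s _))) l k≤l =
  realise-range 3 (Kary.realise k′) n l (≤-trans (m≤m+n 3 k′) k≤l)

proposition1 : (n : ℕ) → 1 ≤ n →
    ((l : ℕ) → 8 ≤ l → l ≤ n →
       ∃[ w ] (length {A = Fin 2} w ≡ n × richness {2} w ≡ l))
    × ((k : ℕ) → 2 < k → (l : ℕ) → k ≤ l → l ≤ n →
       ∃[ w ] (length {A = Fin k} w ≡ n × richness {k} w ≡ l))
proposition1 n _ = realise-range 8 Binary.realise n , kary-range n
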